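{- Any $r$-regular graph $G$ with $r\ge 1$ has a spanning maximum $2$-edge-colorable subgraph.
   Context: Graphs are finite, undirected, without loops, possibly with multiple edges. A subgraph $H$ of $G$ is spanning if every vertex of $G$ has degree at least $1$ in $H$. A maximum $2$-edge-colorable subgraph of $G$ is a subgraph whose edge set is a union of two matchings and which has the maximum possible number of edges among such subgraphs. -}

module Defs where

open import Data.Nat using (ℕ; _≤_; _≥_; _<_)
open import Data.Fin using (Fin; _≟_)
open import Data.Fin.Subset using (Subset; _∈_; _∪_; ∣_∣; inside; outside)
open import Data.Product using (_×_; _,_; proj₁; proj₂; Σ; ∃; ∃-syntax)
open import Data.Sum using (_⊎_)
open import Data.List using (List; length; filter; allFin)
open import Data.Fin.Subset.Properties using (_∈?_)
open import Relation.Binary.PropositionalEquality using (_≡_; _≢_)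
open import Relation.Nullary using (¬_; Dec; yes; no)
open import Relation.Nullary.Decidable using (_⊎-dec_; _×-dec_)
open import Relation.Unary using (Decidable)

-- A finite multigraph without loops: vertices Fin n, edges Fin m,
-- each edge has two distinct endpoints (parallel edges allowed).
record Graph : Set where
  field
    n     : ℕ
    m     : ℕ
    ends  : Fin m → Fin n × Fin n
    loopless : (e : Fin m) → proj₁ (ends e) ≢ proj₂ (ends e)

open Graph public

Incident : (G : Graph) → Fin (m G) → Fin (n G) → Set
Incident G e v = (proj₁ (ends G e) ≡ v) ⊎ (proj₂ (ends G e) ≡ v)

incident? : (G : Graph) (v : Fin (n G)) → Decidable (λ e → Incident G e v)
incident? G v e = (proj₁ (ends G e) ≟ v) ⊎-dec (proj₂ (ends G e) ≟ v)

-- A subgraph is given by its edge set (a subset of the edges of G).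
EdgeSet : Graph → Set
EdgeSet G = Subset (m G)

-- degree of v in the subgraph with edge set H (number of edges of H at v;
-- since there are no loops each incident edge contributes 1)
degreeIn : (G : Graph) → EdgeSet G → Fin (n G) → ℕ
degreeIn G H v = length (filter (λ e → (incident? G v e) ×-dec (e ∈? H)) (allFin (m G)))

degree : (G : Graph) → Fin (n G) → ℕ
degree G v = length (filter (incident? G v) (allFin (m G)))

Regular : ℕ → Graph → Set
Regular r G = (v : Fin (n G)) → degree G v ≡ r

Spanning : (G : Graph) → EdgeSet G → Set
Spanning G H = (v : Fin (n G)) → 1 ≤ degreeIn G H v

IsMatching : (G : Graph) → EdgeSet G → Set
IsMatching G M = (e f : Fin (m G)) → e ∈ M → f ∈ M → e ≢ f →
                 (v : Fin (n G)) → Incident G e v → ¬ Incident G f v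

TwoEdgeColorable : (G : Graph) → EdgeSet G → Set
TwoEdgeColorable G H = ∃[ M₁ ] ∃[ M₂ ] (IsMatching G M₁ × IsMatching G M₂ × H ≡ M₁ ∪ M₂)

IsMax2EdgeColorable : (G : Graph) → EdgeSet G → Set
IsMax2EdgeColorable G H =
  TwoEdgeColorable G H × ((H' : EdgeSet G) → TwoEdgeColorable G H' → ∣ H' ∣ ≤ ∣ H ∣)

module Submission where

-- We work with partial proper 2-edge-colourings K (each colour class is a
-- matching) and call K optimal when it maximises, lexicographically, the
-- number of coloured edges and then the number of covered vertices.  Optimal
-- colourings exist by a finite search, and the coloured edges of one form a
-- maximum 2-edge-colourable subgraph; the point is that it is spanning.
-- Suppose an optimal H leaves v₀ uncovered.  A 'swap' moves the colour of an
-- edge a at z onto an edge f joining z to an uncovered vertex; swaps at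
-- 'centres' keep the colouring optimal, and the vertices left uncovered by
-- some colouring reachable this way obey local rules (their neighbours are
-- centres of H, the coloured edges of H at such a centre lead to further
-- uncoverable vertices, ...).  Double counting over the edges then shows that,
-- by regularity, there are at most as many uncoverable vertices as centres
-- next to them, but also more than twice as many: a contradiction.

open import Defs

open import Data.Nat hiding (_≟_)
open import Data.Nat.Properties hiding (_≟_; 0≢1+n; suc-injective)
open import Data.Fin using (Fin; zero; suc; _≟_; punchIn)
open import Data.Fin.Properties using (suc-injective; 0≢1+n; punchInᵢ≢i; all?; any?; ∀-cons)
open import Data.Fin.Subset using (Subset; ∣_∣; inside; _∈_; _∪_)
open import Data.Fin.Subset.Properties using (_∈?_)
open import Data.Vec using (Vec; []; _∷_; lookup; tabulate; replicate)
open import Data.Vec.Properties using (lookup∘tabulate; lookup-replicate; lookup-zipWith; []=⇒lookup; lookup⇒[]=)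
open import Data.Vec.Functional using (removeAt; updateAt)
open import Data.Vec.Functional.Properties using (updateAt-updates; updateAt-minimal)
open import Data.Maybe using (Maybe; just; nothing)
open import Data.Maybe.Properties using (≡-dec; just-injective)
open import Data.Bool using (Bool; true; false; _∨_)
open import Data.Bool.Properties using () renaming (_≟_ to _≟ᵇ_)
open import Data.Fin.Permutation using (transpose)
import Data.Fin.Permutation.Components as Components
open import Data.List using (List; []; _∷_; length; filter) renaming (tabulate to listTabulate)
import Data.List as List
open import Data.List.Membership.Propositional using () renaming (_∈_ to _∈ˡ_)
open import Data.List.Relation.Unary.Any using (here; there)
import Data.List.Relation.Unary.Any as Any
open import Data.List.Relation.Unary.Any.Properties using (map⁺)
open import Data.List.Extrema.Nat using (argmax; v≤f[argmax]⁺)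
open import Data.Product using (_×_; _,_; proj₁; proj₂; ∃-syntax)
open import Data.Sum using (_⊎_; inj₁; inj₂; [_,_]′)
open import Data.Empty using (⊥; ⊥-elim)
open import Function using (_∘_; const; case_of_)
open import Relation.Binary.PropositionalEquality
open import Relation.Nullary using (¬_; Dec; yes; no; does; ¬¬-excluded-middle)
open import Relation.Nullary.Decidable using (_⊎-dec_; _×-dec_; _→-dec_; ¬?)
open import Relation.Binary using (DecidableEquality)
open import Relation.Unary using (Pred; Decidable)
open import Algebra.Properties.Semiring.Sum +-*-semiring
  using (sum; sum-cong-≗; ∑-distrib-+; ∑-comm; *-distribˡ-sum; ∑-permute; sum-replicate-zero; sum-remove)

sum-mono : ∀ {k} {f g : Fin k → ℕ} → (∀ i → f i ≤ g i) → sum f ≤ sum g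
sum-mono {zero}  _  = z≤n
sum-mono {suc k} le = +-mono-≤ (le zero) (sum-mono (le ∘ suc))

sum-mono-< : ∀ {k} {f g : Fin k → ℕ} → (∀ i → f i ≤ g i) → ∀ j → f j < g j → sum f < sum g
sum-mono-< le zero    lt = +-mono-<-≤ lt (sum-mono (le ∘ suc))
sum-mono-< le (suc j) lt = +-mono-≤-< (le zero) (sum-mono-< (le ∘ suc) j lt)

term≤sum : ∀ {k} (f : Fin k → ℕ) i → f i ≤ sum f
term≤sum f zero    = m≤m+n (f zero) _
term≤sum f (suc i) = ≤-trans (term≤sum (f ∘ suc) i) (m≤n+m _ (f zero))

two-terms≤sum : ∀ {k} (f : Fin k → ℕ) {i j} → i ≢ j → f i + f j ≤ sum f
two-terms≤sum f {zero}  {zero}  i≢j = ⊥-elim (i≢j refl)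
two-terms≤sum f {zero}  {suc j} _   = +-monoʳ-≤ (f zero) (term≤sum (f ∘ suc) j)
two-terms≤sum f {suc i} {zero}  _   =
  subst (_≤ sum f) (+-comm (f zero) (f (suc i))) (+-monoʳ-≤ (f zero) (term≤sum (f ∘ suc) i))
two-terms≤sum f {suc i} {suc j} i≢j =
  ≤-trans (two-terms≤sum (f ∘ suc) (i≢j ∘ cong suc)) (m≤n+m _ (f zero))

sum-≤1 : ∀ {k} (f : Fin k → ℕ) → (∀ i → f i ≤ 1) →
         (∀ i j → 1 ≤ f i → 1 ≤ f j → i ≡ j) → sum f ≤ 1
sum-≤1 {zero}  f bound unique = z≤n
sum-≤1 {suc k} f bound unique with 1 ≤? f zero
... | yes 1≤f₀ = +-mono-≤ (bound zero) restZero
  where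
  restZero : sum (f ∘ suc) ≤ 0
  restZero = ≤-trans (sum-mono {g = λ _ → 0} termZero) (≤-reflexive (sum-replicate-zero k))
    where
    termZero : ∀ i → f (suc i) ≤ 0
    termZero i with 1 ≤? f (suc i)
    ... | yes 1≤fᵢ = ⊥-elim (0≢1+n (unique zero (suc i) 1≤f₀ 1≤fᵢ))
    ... | no  1≰fᵢ = ≤-pred (≰⇒> 1≰fᵢ)
... | no  1≰f₀ = +-mono-≤ (≤-pred (≰⇒> 1≰f₀))
                          (sum-≤1 (f ∘ suc) (bound ∘ suc) (λ i j p q → suc-injective (unique (suc i) (suc j) p q)))

sum-ones : ∀ k → sum {k} (λ _ → 1) ≡ k
sum-ones zero    = refl
sum-ones (suc k) = cong suc (sum-ones k)

sum-≤-exchange : ∀ {k} {f g : Fin k → ℕ} (i j : Fin k) → f i ≤ g j → f j ≤ g i →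
                 (∀ w → w ≢ i → w ≢ j → f w ≤ g w) → sum f ≤ sum g
sum-≤-exchange {f = f} {g} i j fᵢ≤gⱼ fⱼ≤gᵢ elsewhere = begin
  sum f                                       ≤⟨ sum-mono swapped ⟩
  sum (λ w → g (Components.transpose i j w))  ≡⟨ ∑-permute g (transpose i j) ⟨
  sum g                                       ∎
  where
  open ≤-Reasoning
  swapped : ∀ w → f w ≤ g (Components.transpose i j w)
  swapped w with w ≟ i
  ... | yes refl = fᵢ≤gⱼ
  ... | no  w≢i with w ≟ j
  ...   | yes refl = fⱼ≤gᵢ
  ...   | no  w≢j  = elsewhere w w≢i w≢j

𝟙 : ∀ {p} {P : Set p} → Dec P → ℕ
𝟙 (yes _) = 1
𝟙 (no  _) = 0

𝟙-yes : ∀ {p} {P : Set p} (d : Dec P) → P → 𝟙 d ≡ 1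
𝟙-yes (yes _) _  = refl
𝟙-yes (no ¬p) pf = ⊥-elim (¬p pf)

𝟙-no : ∀ {p} {P : Set p} (d : Dec P) → ¬ P → 𝟙 d ≡ 0
𝟙-no (yes pf) ¬p = ⊥-elim (¬p pf)
𝟙-no (no _)   _  = refl

𝟙≤1 : ∀ {p} {P : Set p} (d : Dec P) → 𝟙 d ≤ 1
𝟙≤1 (yes _) = ≤-refl
𝟙≤1 (no _)  = z≤n

𝟙-witness : ∀ {p} {P : Set p} (d : Dec P) → 1 ≤ 𝟙 d → P
𝟙-witness (yes pf) _ = pf

𝟙-mono : ∀ {p q} {P : Set p} {Q : Set q} (dp : Dec P) (dq : Dec Q) → (P → Q) → 𝟙 dp ≤ 𝟙 dq
𝟙-mono (yes pf) dq       P⇒Q = ≤-reflexive (sym (𝟙-yes dq (P⇒Q pf)))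
𝟙-mono (no _)   _        _   = z≤n

does-witness : ∀ {p} {P : Set p} (d : Dec P) → does d ≡ true → P
does-witness (yes pf) _ = pf

𝟙-⊎ : ∀ {p q} {P : Set p} {Q : Set q} (dp : Dec P) (dq : Dec Q) → ¬ (P × Q) →
      𝟙 (dp ⊎-dec dq) ≡ 𝟙 dp + 𝟙 dq
𝟙-⊎ (yes pf) (yes qf) excl = ⊥-elim (excl (pf , qf))
𝟙-⊎ (yes _)  (no _)   _    = refl
𝟙-⊎ (no _)   (yes _)  _    = refl
𝟙-⊎ (no _)   (no _)   _    = refl

count : ∀ {k p} {P : Fin k → Set p} → (∀ i → Dec (P i)) → ℕ
count P? = sum (λ i → 𝟙 (P? i))

module _ {k p q} {P : Fin k → Set p} {Q : Fin k → Set q}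
         (P? : ∀ i → Dec (P i)) (Q? : ∀ i → Dec (Q i)) where

  count-< : (∀ i → P i → Q i) → ∀ j → Q j → ¬ P j → count P? < count Q?
  count-< P⊆Q j qj ¬pj = sum-mono-< (λ i → 𝟙-mono (P? i) (Q? i) (P⊆Q i)) j
    (subst₂ _<_ (sym (𝟙-no (P? j) ¬pj)) (sym (𝟙-yes (Q? j) qj)) ≤-refl)

  count-exchange : ∀ i j → (P i → Q j) → (P j → Q i) → (∀ w → w ≢ i → w ≢ j → P w → Q w) →
                   count P? ≤ count Q?
  count-exchange i j Pi⇒Qj Pj⇒Qi elsewhere = sum-≤-exchange i j
    (𝟙-mono (P? i) (Q? j) Pi⇒Qj) (𝟙-mono (P? j) (Q? i) Pj⇒Qi)
    (λ w w≢i w≢j → 𝟙-mono (P? w) (Q? w) (elsewhere w w≢i w≢j))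

module _ {k p} {P : Fin k → Set p} (P? : ∀ i → Dec (P i)) where

  count≤size : count P? ≤ k
  count≤size = ≤-trans (sum-mono (λ i → 𝟙≤1 (P? i))) (≤-reflexive (sum-ones k))

  count-≥1 : ∀ {i} → P i → 1 ≤ count P?
  count-≥1 {i} pi = ≤-trans (≤-reflexive (sym (𝟙-yes (P? i) pi))) (term≤sum (λ w → 𝟙 (P? w)) i)

  count-≥2 : ∀ {i j} → i ≢ j → P i → P j → 2 ≤ count P?
  count-≥2 {i} {j} i≢j pi pj = ≤-trans (≤-reflexive (sym (cong₂ _+_ (𝟙-yes (P? i) pi) (𝟙-yes (P? j) pj))))
                                       (two-terms≤sum (λ w → 𝟙 (P? w)) i≢j)

  count-≤1 : (∀ i j → P i → P j → i ≡ j) → count P? ≤ 1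
  count-≤1 unique = sum-≤1 (λ i → 𝟙 (P? i)) (λ i → 𝟙≤1 (P? i))
    (λ i j 1≤i 1≤j → unique i j (𝟙-witness (P? i) 1≤i) (𝟙-witness (P? j) 1≤j))

  count-0 : (∀ i → ¬ P i) → count P? ≡ 0
  count-0 none = trans (sum-cong-≗ (λ i → 𝟙-no (P? i) (none i))) (sum-replicate-zero k)

𝟙-× : ∀ {p q} {P : Set p} {Q : Set q} (dp : Dec P) (dq : Dec Q) → 𝟙 (dp ×-dec dq) ≡ 𝟙 dp * 𝟙 dq
𝟙-× (yes _) (yes _) = refl
𝟙-× (yes _) (no _)  = refl
𝟙-× (no _)  _       = refl

sum-select : ∀ {k} (S : Fin k → ℕ) (a : Fin k) → sum (λ x → S x * 𝟙 (a ≟ x)) ≡ S a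
sum-select {suc k} S a = begin
  sum term                              ≡⟨ sum-remove term ⟩
  term a + sum (removeAt term a)        ≡⟨ cong₂ _+_ (cong (S a *_) (𝟙-yes (a ≟ a) refl)) restZero ⟩
  S a * 1 + 0                           ≡⟨ cong (_+ 0) (*-identityʳ (S a)) ⟩
  S a + 0                               ≡⟨ +-identityʳ (S a) ⟩
  S a                                   ∎
  where
  open ≡-Reasoning
  term : Fin (suc k) → ℕ
  term x = S x * 𝟙 (a ≟ x)
  offPoint : ∀ j → term (punchIn a j) ≡ 0
  offPoint j = trans (cong (S (punchIn a j) *_) (𝟙-no (a ≟ punchIn a j) (punchInᵢ≢i a j ∘ sym)))
                     (*-zeroʳ (S (punchIn a j)))
  restZero : sum (removeAt term a) ≡ 0
  restZero = trans (sum-cong-≗ offPoint) (sum-replicate-zero k)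

length-filter : ∀ {a p} {A : Set a} {P : Pred A p} (P? : Decidable P) {k} (f : Fin k → A) →
                length (filter P? (listTabulate f)) ≡ sum (λ i → 𝟙 (P? (f i)))
length-filter P? {zero}  f = refl
length-filter P? {suc k} f with P? (f zero)
... | yes _ = cong suc (length-filter P? (f ∘ suc))
... | no  _ = length-filter P? (f ∘ suc)

∣_∣≡sum : ∀ {k} (p : Subset k) → ∣ p ∣ ≡ sum (λ i → 𝟙 (lookup p i ≟ᵇ inside))
∣ []         ∣≡sum = refl
∣ true  ∷ p  ∣≡sum = cong suc ∣ p ∣≡sum
∣ false ∷ p  ∣≡sum = ∣ p ∣≡sum

module GraphFacts (G : Graph) where

  Vertex : Set
  Vertex = Fin (n G)

  Edge : Set
  Edge = Fin (m G)

  Inc : Edge → Vertex → Set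
  Inc = Incident G

  inc? : ∀ e x → Dec (Inc e x)
  inc? e x = incident? G x e

  endA endB : Edge → Vertex
  endA e = proj₁ (ends G e)
  endB e = proj₂ (ends G e)

  endB≢endA : ∀ e → endB e ≢ endA e
  endB≢endA e = loopless G e ∘ sym

  two-ends : ∀ {e v y w} → Inc e v → Inc e y → y ≢ v → Inc e w → w ≡ v ⊎ w ≡ y
  two-ends (inj₁ p) (inj₁ q) y≢v _        = ⊥-elim (y≢v (trans (sym q) p))
  two-ends (inj₂ p) (inj₂ q) y≢v _        = ⊥-elim (y≢v (trans (sym q) p))
  two-ends (inj₁ p) (inj₂ q) _   (inj₁ r) = inj₁ (trans (sym r) p)
  two-ends (inj₁ p) (inj₂ q) _   (inj₂ r) = inj₂ (trans (sym r) q)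
  two-ends (inj₂ p) (inj₁ q) _   (inj₁ r) = inj₂ (trans (sym r) q)
  two-ends (inj₂ p) (inj₁ q) _   (inj₂ r) = inj₁ (trans (sym r) p)

  weightedDegree : (Edge → ℕ) → Vertex → ℕ
  weightedDegree W x = sum (λ e → W e * 𝟙 (inc? e x))

  handshake : (S : Vertex → ℕ) (W : Edge → ℕ) →
              sum (λ x → S x * weightedDegree W x) ≡ sum (λ e → W e * (S (endA e) + S (endB e)))
  handshake S W = begin
    sum (λ x → S x * sum (λ e → W e * 𝟙 (inc? e x)))
      ≡⟨ sum-cong-≗ (λ x → *-distribˡ-sum (S x) (λ e → W e * 𝟙 (inc? e x))) ⟩
    sum (λ x → sum (λ e → S x * (W e * 𝟙 (inc? e x))))
      ≡⟨ ∑-comm (λ x e → S x * (W e * 𝟙 (inc? e x))) ⟩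
    sum (λ e → sum (λ x → S x * (W e * 𝟙 (inc? e x))))
      ≡⟨ sum-cong-≗ (λ e → sum-cong-≗ (λ x → rearrange (S x) (W e) _)) ⟩
    sum (λ e → sum (λ x → W e * (S x * 𝟙 (inc? e x))))
      ≡⟨ sum-cong-≗ (λ e → sym (*-distribˡ-sum (W e) (λ x → S x * 𝟙 (inc? e x)))) ⟩
    sum (λ e → W e * sum (λ x → S x * 𝟙 (inc? e x)))
      ≡⟨ sum-cong-≗ (λ e → cong (W e *_) (ends-sum e)) ⟩
    sum (λ e → W e * (S (endA e) + S (endB e))) ∎
    where
    open ≡-Reasoning
    rearrange : ∀ s w i → s * (w * i) ≡ w * (s * i)
    rearrange s w i = trans (sym (*-assoc s w i)) (trans (cong (_* i) (*-comm s w)) (*-assoc w s i))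
    -- an edge is incident exactly with its two (distinct) ends
    ends-sum : ∀ e → sum (λ x → S x * 𝟙 (inc? e x)) ≡ S (endA e) + S (endB e)
    ends-sum e = begin
      sum (λ x → S x * 𝟙 (inc? e x))
        ≡⟨ sum-cong-≗ (λ x → cong (S x *_) (𝟙-⊎ (endA e ≟ x) (endB e ≟ x) noLoop)) ⟩
      sum (λ x → S x * (𝟙 (endA e ≟ x) + 𝟙 (endB e ≟ x)))
        ≡⟨ sum-cong-≗ (λ x → *-distribˡ-+ (S x) _ _) ⟩
      sum (λ x → S x * 𝟙 (endA e ≟ x) + S x * 𝟙 (endB e ≟ x))
        ≡⟨ ∑-distrib-+ (λ x → S x * 𝟙 (endA e ≟ x)) (λ x → S x * 𝟙 (endB e ≟ x)) ⟩
      sum (λ x → S x * 𝟙 (endA e ≟ x)) + sum (λ x → S x * 𝟙 (endB e ≟ x))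
        ≡⟨ cong₂ _+_ (sum-select S (endA e)) (sum-select S (endB e)) ⟩
      S (endA e) + S (endB e) ∎
      where
      noLoop : ∀ {x} → ¬ (endA e ≡ x × endB e ≡ x)
      noLoop (p , q) = loopless G e (trans p (sym q))

  regular-handshake : ∀ {r} → Regular r G → (S : Vertex → ℕ) →
                      sum S * r ≡ sum (λ e → S (endA e) + S (endB e))
  regular-handshake {r} reg S = begin
    sum S * r
      ≡⟨ *-comm (sum S) r ⟩
    r * sum S
      ≡⟨ *-distribˡ-sum r S ⟩
    sum (λ x → r * S x)
      ≡⟨ sum-cong-≗ (λ x → trans (*-comm r (S x)) (cong (S x *_) (sym (unitDegree x)))) ⟩
    sum (λ x → S x * weightedDegree (λ _ → 1) x)
      ≡⟨ handshake S (λ _ → 1) ⟩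
    sum (λ e → 1 * (S (endA e) + S (endB e)))
      ≡⟨ sum-cong-≗ (λ e → *-identityˡ (S (endA e) + S (endB e))) ⟩
    sum (λ e → S (endA e) + S (endB e)) ∎
    where
    open ≡-Reasoning
    unitDegree : ∀ x → weightedDegree (λ _ → 1) x ≡ r
    unitDegree x = begin
      weightedDegree (λ _ → 1) x          ≡⟨ sum-cong-≗ (λ e → *-identityˡ (𝟙 (inc? e x))) ⟩
      sum (λ e → 𝟙 (incident? G x e))     ≡⟨ length-filter (incident? G x) (λ e → e) ⟨
      degree G x                          ≡⟨ reg x ⟩
      r                                   ∎

-- Numbers written with a leading digit a and a trailing digit c ≤ N in base
-- N + 1 are ordered by their leading digits.
lex-< : ∀ {N a b c d} → a < b → c ≤ N → a * suc N + c < b * suc N + d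
lex-< {N} {a} {b} {c} {d} a<b c≤N = begin-strict
  a * suc N + c          ≤⟨ +-monoʳ-≤ (a * suc N) c≤N ⟩
  a * suc N + N          <⟨ +-monoʳ-< (a * suc N) (n<1+n N) ⟩
  a * suc N + suc N      ≡⟨ +-comm (a * suc N) (suc N) ⟩
  suc a * suc N          ≤⟨ *-monoˡ-≤ (suc N) a<b ⟩
  b * suc N              ≤⟨ m≤m+n (b * suc N) d ⟩
  b * suc N + d          ∎
  where open ≤-Reasoning

data Colour : Set where
  red blue : Colour

opposite : Colour → Colour
opposite red  = blue
opposite blue = red

opposite-≢ : ∀ d → opposite d ≢ d
opposite-≢ red  ()
opposite-≢ blue ()

opposite-involutive : ∀ d → opposite (opposite d) ≡ d
opposite-involutive red  = refl
opposite-involutive blue = refl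

other-colour : ∀ {d d'} → d' ≢ d → d' ≡ opposite d
other-colour {red}  {red}  d'≢d = ⊥-elim (d'≢d refl)
other-colour {red}  {blue} _    = refl
other-colour {blue} {red}  _    = refl
other-colour {blue} {blue} d'≢d = ⊥-elim (d'≢d refl)

_≟ᶜ_ : DecidableEquality Colour
red  ≟ᶜ red  = yes refl
red  ≟ᶜ blue = no λ ()
blue ≟ᶜ red  = no λ ()
blue ≟ᶜ blue = yes refl

all-colours? : ∀ {p} {P : Colour → Set p} → (∀ d → Dec (P d)) → Dec (∀ d → P d)
all-colours? P? with P? red | P? blue
... | yes pr | yes pb = yes λ { red → pr ; blue → pb }
... | no ¬pr | _      = no λ all → ¬pr (all red)
... | _      | no ¬pb = no λ all → ¬pb (all blue)

some-colour? : ∀ {p} {P : Colour → Set p} → (∀ d → Dec (P d)) → Dec (∃[ d ] P d)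
some-colour? P? with P? red | P? blue
... | yes pr | _      = yes (red , pr)
... | no _   | yes pb = yes (blue , pb)
... | no ¬pr | no ¬pb = no λ { (red , pr) → ¬pr pr ; (blue , pb) → ¬pb pb }

Coloured : Maybe Colour → Set
Coloured c = ∃[ d ] (c ≡ just d)

coloured? : ∀ c → Dec (Coloured c)
coloured? nothing  = no λ ()
coloured? (just d) = yes (d , refl)

-- The optimal ones first maximise the number of coloured edges and then the
-- number of covered vertices; this lexicographic order is encoded in 'score'.
module Colourings (G : Graph) where

  open GraphFacts G

  Colouring : Set
  Colouring = Edge → Maybe Colour

  Proper : Colouring → Set
  Proper K = ∀ d e f → K e ≡ just d → K f ≡ just d → e ≢ f → ∀ v → Inc e v → ¬ Inc f v

  proper? : ∀ K → Dec (Proper K)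
  proper? K = all-colours? λ d → all? λ e → all? λ f →
    (≡-dec _≟ᶜ_ (K e) (just d)) →-dec ((≡-dec _≟ᶜ_ (K f) (just d)) →-dec
      (¬? (e ≟ f) →-dec all? λ v → inc? e v →-dec ¬? (inc? f v)))

  CoveredBy : Colouring → Colour → Vertex → Set
  CoveredBy K d x = ∃[ e ] (K e ≡ just d × Inc e x)

  Covered : Colouring → Vertex → Set
  Covered K x = ∃[ d ] CoveredBy K d x

  coveredBy? : ∀ K d x → Dec (CoveredBy K d x)
  coveredBy? K d x = any? λ e → ≡-dec _≟ᶜ_ (K e) (just d) ×-dec inc? e x

  covered? : ∀ K x → Dec (Covered K x)
  covered? K x = some-colour? λ d → coveredBy? K d x

  uncovered-uncoloured : ∀ {K x e} → ¬ Covered K x → Inc e x → K e ≡ nothing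
  uncovered-uncoloured {K} {x} {e} ¬cov e-x with K e in Ke
  ... | nothing = refl
  ... | just d  = ⊥-elim (¬cov (d , e , Ke , e-x))

  size coverage : Colouring → ℕ
  size     K = count (λ e → coloured? (K e))
  coverage K = count (covered? K)

  score : Colouring → ℕ
  score K = size K * suc (n G) + coverage K

  Optimal : Colouring → Set
  Optimal K = Proper K × (∀ K' → Proper K' → score K' ≤ score K)

  recolour : Colouring → Edge → Maybe Colour → Colouring
  recolour K e c = updateAt K e (const c)

  recolour-here : ∀ K e c → recolour K e c e ≡ c
  recolour-here K e c = updateAt-updates e K

  recolour-elsewhere : ∀ K {e e'} c → e' ≢ e → recolour K e c e' ≡ K e'
  recolour-elsewhere K {e} {e'} c e'≢e = updateAt-minimal e' e K e'≢e

  score-size-< : ∀ {K K'} → size K < size K' → score K < score K'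
  score-size-< {K} lt = lex-< lt (count≤size (covered? K))

  score-≤ : ∀ {K K'} → size K ≤ size K' → coverage K ≤ coverage K' → score K ≤ score K'
  score-≤ sizes coverages = +-mono-≤ (*-monoˡ-≤ _ sizes) coverages

  score-coverage-< : ∀ {K K'} → size K ≤ size K' → coverage K < coverage K' → score K < score K'
  score-coverage-< sizes coverages = +-mono-≤-< (*-monoˡ-≤ _ sizes) coverages

  optimal-size : ∀ {K K'} → Optimal K → Proper K' → size K' ≤ size K
  optimal-size (_ , best) properK' = ≮⇒≥ λ lt → <⇒≱ (score-size-< lt) (best _ properK')

  optimal-≤ : ∀ {K K'} → Optimal K → Proper K' → score K ≤ score K' → Optimal K'
  optimal-≤ (_ , best) properK' le = properK' , λ K'' properK'' → ≤-trans (best K'' properK'') le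

  recolour-view : ∀ K f c e → (e ≡ f × recolour K f c e ≡ c) ⊎ (e ≢ f × recolour K f c e ≡ K e)
  recolour-view K f c e with e ≟ f
  ... | yes refl = inj₁ (refl , recolour-here K f c)
  ... | no e≢f   = inj₂ (e≢f , recolour-elsewhere K c e≢f)

  proper-uncolour : ∀ {K} a → Proper K → Proper (recolour K a nothing)
  proper-uncolour {K} a properK d e e' Ke Ke' = properK d e e' (was Ke) (was Ke')
    where
    was : ∀ {e} → recolour K a nothing e ≡ just d → K e ≡ just d
    was {e} eq with recolour-view K a nothing e
    ... | inj₁ (_ , now) = case trans (sym now) eq of λ ()
    ... | inj₂ (_ , now) = trans (sym now) eq

  proper-colour : ∀ {K f d} → Proper K → (∀ e → e ≢ f → K e ≡ just d → ∀ w → Inc f w → ¬ Inc e w) →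
                  Proper (recolour K f (just d))
  proper-colour {K} {f} {d} properK free d' e e' Ke Ke' e≢e' v iev ie'v
    with recolour-view K f (just d) e | recolour-view K f (just d) e'
  ... | inj₁ (refl , _)     | inj₁ (refl , _)     = e≢e' refl
  ... | inj₁ (refl , now)   | inj₂ (e'≢f , now')  =
    free e' e'≢f (trans (sym now') (trans Ke' (trans (sym Ke) now))) v iev ie'v
  ... | inj₂ (e≢f , now)    | inj₁ (refl , now')  =
    free e e≢f (trans (sym now) (trans Ke (trans (sym Ke') now'))) v ie'v iev
  ... | inj₂ (_ , now)      | inj₂ (_ , now')     =
    properK d' e e' (trans (sym now) Ke) (trans (sym now') Ke') e≢e' v iev ie'v

-- A swap site for K is a path x –f– z –a– p in
-- which x is uncovered and a has colour d; the swap moves colour d from a to f.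
-- It keeps the number of coloured edges, covers x and can only uncover p.
module Swaps (G : Graph) where

  open GraphFacts G
  open Colourings G

  record Site (K : Colouring) : Set where
    field
      x z p       : Vertex
      f a         : Edge
      d           : Colour
      x-uncovered : ¬ Covered K x
      f-x         : Inc f x
      f-z         : Inc f z
      z≢x         : z ≢ x
      a-colour    : K a ≡ just d
      a-z         : Inc a z
      a-p         : Inc a p
      p≢z         : p ≢ z

  swap : ∀ {K} → Site K → Colouring
  swap {K} s = recolour (recolour K a nothing) f (just d)
    where open Site s

  module SwapFacts {K : Colouring} (properK : Proper K) (s : Site K) where

    open Site s

    K' : Colouring
    K' = swap s

    f-uncoloured : K f ≡ nothing
    f-uncoloured = uncovered-uncoloured x-uncovered f-x

    f-coloured : K' f ≡ just d
    f-coloured = recolour-here _ f (just d)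

    -- The colour of a moves to f, so z stays covered by it.
    z-covered : ∀ {d'} → K a ≡ just d' → CoveredBy K' d' z
    z-covered Ka = f , trans f-coloured (cong just (just-injective (trans (sym a-colour) Ka))) , f-z

    x≢p : x ≢ p
    x≢p refl = x-uncovered (d , a , a-colour , a-p)

    data EdgeCase (e : Edge) : Set where
      at-f      : e ≡ f → K' e ≡ just d → EdgeCase e
      at-a      : e ≡ a → K' e ≡ nothing → EdgeCase e
      elsewhere : e ≢ f → e ≢ a → K' e ≡ K e → EdgeCase e

    edge-case : ∀ e → EdgeCase e
    edge-case e with recolour-view (recolour K a nothing) f (just d) e
    ... | inj₁ (e≡f , now) = at-f e≡f now
    ... | inj₂ (e≢f , now) with recolour-view K a nothing e
    ...   | inj₁ (e≡a , was) = at-a e≡a (trans now was)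
    ...   | inj₂ (e≢a , was) = elsewhere e≢f e≢a (trans now was)

    ends-of-f : ∀ {w} → Inc f w → w ≡ x ⊎ w ≡ z
    ends-of-f = two-ends f-x f-z z≢x

    ends-of-a : ∀ {w} → Inc a w → w ≡ z ⊎ w ≡ p
    ends-of-a = two-ends a-z a-p p≢z

    coveredBy-kept : ∀ {d' w} → CoveredBy K d' w → CoveredBy K' d' w ⊎ (w ≡ p × d' ≡ d)
    coveredBy-kept (e , Ke , e-w) with edge-case e
    ... | at-f refl _        = case trans (sym Ke) f-uncoloured of λ ()
    ... | elsewhere _ _ same = inj₁ (e , trans same Ke , e-w)
    ... | at-a refl _ with ends-of-a e-w
    ...   | inj₁ refl = inj₁ (z-covered Ke)
    ...   | inj₂ w≡p  = inj₂ (w≡p , just-injective (trans (sym Ke) a-colour))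

    proper-swap : Proper K'
    proper-swap = proper-colour (proper-uncolour a properK) free
      where
      free : ∀ e → e ≢ f → recolour K a nothing e ≡ just d → ∀ w → Inc f w → ¬ Inc e w
      free e e≢f Ke w f-w e-w with recolour-view K a nothing e
      ... | inj₁ (_ , now)     = case trans (sym now) Ke of λ ()
      ... | inj₂ (e≢a , now) with ends-of-f f-w
      ...   | inj₁ refl = x-uncovered (d , e , trans (sym now) Ke , e-w)
      ...   | inj₂ refl = properK d e a (trans (sym now) Ke) a-colour e≢a w e-w a-z

    size-swap : size K ≤ size K'
    size-swap = count-exchange (λ e → coloured? (K e)) (λ e → coloured? (K' e)) a f
      (λ _ → d , f-coloured)
      (λ { (_ , Kf) → case trans (sym f-uncoloured) Kf of λ () })
      (λ e e≢a e≢f coloured → subst Coloured (sym (unchanged e e≢f e≢a)) coloured)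
      where
      unchanged : ∀ e → e ≢ f → e ≢ a → K' e ≡ K e
      unchanged e e≢f e≢a = trans (recolour-elsewhere _ (just d) e≢f) (recolour-elsewhere K nothing e≢a)

    covered-kept : ∀ w → w ≢ p → Covered K w → Covered K' w
    covered-kept w w≢p (d' , covered) with coveredBy-kept covered
    ... | inj₁ covered′    = d' , covered′
    ... | inj₂ (w≡p , _) = ⊥-elim (w≢p w≡p)

    x-covered : Covered K' x
    x-covered = d , f , f-coloured , f-x

    coverage-swap : coverage K ≤ coverage K'
    coverage-swap = count-exchange (covered? K) (covered? K') p x
      (λ _ → x-covered) (λ covered → ⊥-elim (x-uncovered covered))
      (λ w w≢p _ → covered-kept w w≢p)

    score-swap : score K ≤ score K'
    score-swap = score-≤ size-swap coverage-swap

    score-swap-< : CoveredBy K (opposite d) p → score K < score K'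
    score-swap-< opposite-at-p = score-coverage-< size-swap
      (count-< (covered? K) (covered? K') kept x x-covered x-uncovered)
      where
      p-kept : Covered K' p
      p-kept with coveredBy-kept opposite-at-p
      ... | inj₁ covered′     = opposite d , covered′
      ... | inj₂ (_ , opp≡d) = ⊥-elim (opposite-≢ d opp≡d)
      kept : ∀ w → Covered K w → Covered K' w
      kept w covered with w ≟ p
      ... | yes refl = p-kept
      ... | no w≢p   = covered-kept w w≢p covered

    p-uncovered : ¬ CoveredBy K (opposite d) p → ¬ Covered K' p
    p-uncovered ¬opp (d' , e , K'e , e-p) with edge-case e
    ... | at-a refl now = case trans (sym now) K'e of λ ()
    ... | at-f refl _ with ends-of-f e-p
    ...   | inj₁ p≡x = x≢p (sym p≡x)
    ...   | inj₂ p≡z = p≢z p≡z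
    p-uncovered ¬opp (d' , e , K'e , e-p) | elsewhere _ e≢a same with d' ≟ᶜ d
    ... | yes refl = properK d e a (trans (sym same) K'e) a-colour e≢a p e-p a-p
    ... | no d'≢d  = ¬opp (e , trans (sym same) (trans K'e (cong just (other-colour d'≢d))) , e-p)

-- In an optimal colouring every neighbour of an
-- uncovered vertex is a centre, since otherwise adding an edge or a swap
-- would improve the score.
module Centres (G : Graph) where

  open GraphFacts G
  open Colourings G
  open Swaps G

  Leafy : Colouring → Vertex → Set
  Leafy K z = ∀ d a p → K a ≡ just d → Inc a z → Inc a p → p ≢ z → ¬ CoveredBy K (opposite d) p

  Centre : Colouring → Vertex → Set
  Centre K z = (∀ d → CoveredBy K d z) × Leafy K z

  centre-lemma : ∀ {K x z f} → Optimal K → ¬ Covered K x → Inc f x → Inc f z → z ≢ x → Centre K z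
  centre-lemma {K} {x} {z} {f} (properK , best) ¬cov f-x f-z z≢x = both-colours , leafy
    where
    f-uncoloured : ¬ Coloured (K f)
    f-uncoloured (_ , Kf) = case trans (sym (uncovered-uncoloured ¬cov f-x)) Kf of λ ()

    -- If z missed colour d, colouring f with d would give more coloured edges.
    both-colours : ∀ d → CoveredBy K d z
    both-colours d with coveredBy? K d z
    ... | yes covered = covered
    ... | no ¬covered = ⊥-elim (<⇒≱ (score-size-< more-edges) (best K' properK'))
      where
      K' : Colouring
      K' = recolour K f (just d)
      free : ∀ e → e ≢ f → K e ≡ just d → ∀ w → Inc f w → ¬ Inc e w
      free e _ Ke w f-w e-w with two-ends f-x f-z z≢x f-w
      ... | inj₁ refl = ¬cov (d , e , Ke , e-w)
      ... | inj₂ refl = ¬covered (e , Ke , e-w)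
      properK' : Proper K'
      properK' = proper-colour properK free
      still-coloured : ∀ e → Coloured (K e) → Coloured (K' e)
      still-coloured e (d' , Ke) with recolour-view K f (just d) e
      ... | inj₁ (_ , now) = d , now
      ... | inj₂ (_ , now) = d' , trans now Ke
      more-edges : size K < size K'
      more-edges = count-< (λ e → coloured? (K e)) (λ e → coloured? (K' e)) still-coloured
                           f (d , recolour-here K f (just d)) f-uncoloured

    -- If the far end of a coloured edge at z had the opposite colour, the swap
    -- along x –f– z –a– p would cover strictly more vertices.
    leafy : Leafy K z
    leafy d a p Ka a-z a-p p≢z opposite-at-p =
      <⇒≱ (SwapFacts.score-swap-< properK site opposite-at-p) (best _ (SwapFacts.proper-swap properK site))
      where
      site : Site K
      site = record { x = x ; z = z ; p = p ; f = f ; a = a ; d = d ; x-uncovered = ¬cov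
                    ; f-x = f-x ; f-z = f-z ; z≢x = z≢x ; a-colour = Ka ; a-z = a-z ; a-p = a-p ; p≢z = p≢z }

module Reachability (G : Graph) (H : Colourings.Colouring G) (optimalH : Colourings.Optimal G H) where

  open GraphFacts G
  open Colourings G
  open Swaps G
  open Centres G

  data Reach : Colouring → Set where
    origin : Reach H
    step   : ∀ {K} → Reach K → (s : Site K) → Centre K (Site.z s) → Reach (swap s)

  Uncoverable : Vertex → Set
  Uncoverable ℓ = ∃[ K ] (Reach K × ¬ Covered K ℓ)

  record Invariant (K : Colouring) : Set where
    field
      optimal         : Optimal K
      centres-were    : ∀ y → Centre K y → Centre H y
      centres-covered : ∀ c → Centre H c → ∀ d → CoveredBy K d c
      spokes          : ∀ c ℓ e → Centre H c → Coloured (H e) → Inc e c → Inc e ℓ → ℓ ≢ c →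
                        (∃[ a ] (Coloured (K a) × Inc a c × Inc a ℓ)) ⊎ Uncoverable ℓ

  module StepPreserves {K : Colouring} (reachK : Reach K) (invK : Invariant K)
                       (s : Site K) (centre-z : Centre K (Site.z s)) where

    open Site s
    open Invariant invK
    open SwapFacts (proj₁ optimal) s

    -- The swap is at a centre, so p misses the opposite colour and is uncovered afterwards.
    p-misses : ¬ CoveredBy K (opposite d) p
    p-misses = proj₂ centre-z d a p a-colour a-z a-p p≢z

    p-not-H-centre : ¬ Centre H p
    p-not-H-centre centreH = p-misses (centres-covered p centreH (opposite d))

    optimal′ : Optimal K'
    optimal′ = optimal-≤ optimal proper-swap score-swap

    centres-covered′ : ∀ c → Centre H c → ∀ d' → CoveredBy K' d' c
    centres-covered′ c centreH d' with coveredBy-kept (centres-covered c centreH d')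
    ... | inj₁ covered′    = covered′
    ... | inj₂ (refl , _) = ⊥-elim (p-not-H-centre centreH)

    spokes′ : ∀ c ℓ e → Centre H c → Coloured (H e) → Inc e c → Inc e ℓ → ℓ ≢ c →
              (∃[ a' ] (Coloured (K' a') × Inc a' c × Inc a' ℓ)) ⊎ Uncoverable ℓ
    spokes′ c ℓ e centreH coloured e-c e-ℓ ℓ≢c with spokes c ℓ e centreH coloured e-c e-ℓ ℓ≢c
    ... | inj₂ uncoverable = inj₂ uncoverable
    ... | inj₁ (a' , (d' , Ka') , a'-c , a'-ℓ) with edge-case a'
    ...   | at-f refl _        = case trans (sym Ka') f-uncoloured of λ ()
    ...   | elsewhere _ _ same = inj₁ (a' , (d' , trans same Ka') , a'-c , a'-ℓ)
    ...   | at-a refl _ with ends-of-a a'-ℓ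
    ...     | inj₂ refl = inj₂ (K' , step reachK s centre-z , p-uncovered p-misses)
    ...     | inj₁ refl with ends-of-a a'-c
    ...       | inj₁ c≡z = ⊥-elim (ℓ≢c (sym c≡z))
    ...       | inj₂ refl = ⊥-elim (p-not-H-centre centreH)

    -- A centre y ≠ z of K' is a centre of K: its edges are untouched by the swap.
    centre-before : ∀ {y} → y ≢ z → Centre K' y → Centre K y
    centre-before {y} y≢z (both′ , leafy′) = both , leafy
      where
      y≢x : y ≢ x
      y≢x refl with both′ (opposite d)
      ... | e , K'e , e-x with edge-case e
      ...   | at-f _ now        = opposite-≢ d (just-injective (trans (sym K'e) now))
      ...   | at-a _ now        = case trans (sym now) K'e of λ ()
      ...   | elsewhere _ _ same = x-uncovered (opposite d , e , trans (sym same) K'e , e-x)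
      y≢p : y ≢ p
      y≢p refl = p-uncovered p-misses (red , both′ red)
      unchanged : ∀ {e} → Inc e y → K' e ≡ K e
      unchanged {e} e-y with edge-case e
      ... | at-f refl _ = ⊥-elim ([ y≢x , y≢z ]′ (ends-of-f e-y))
      ... | at-a refl _ = ⊥-elim ([ y≢z , y≢p ]′ (ends-of-a e-y))
      ... | elsewhere _ _ same = same
      both : ∀ d' → CoveredBy K d' y
      both d' with both′ d'
      ... | e , K'e , e-y = e , trans (sym (unchanged e-y)) K'e , e-y
      leafy : Leafy K y
      leafy d' a' q Ka' a'-y a'-q q≢y (e , Ke , e-q) =
        leafy′ d' a' q (trans (unchanged a'-y) Ka') a'-y a'-q q≢y covered′
        where
        covered′ : CoveredBy K' (opposite d') q
        covered′ with coveredBy-kept (e , Ke , e-q)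
        ... | inj₁ covered = covered
        ... | inj₂ (refl , opp≡d) = ⊥-elim (p-misses (a' , trans Ka' (cong just d'≡opp) , a'-q))
          where
          d'≡opp : d' ≡ opposite d
          d'≡opp = trans (sym (opposite-involutive d')) (cong opposite opp≡d)

    centres-were′ : ∀ y → Centre K' y → Centre H y
    centres-were′ y centre′ with y ≟ z
    ... | yes refl = centres-were z centre-z
    ... | no y≢z   = centres-were y (centre-before y≢z centre′)

    invariant′ : Invariant K'
    invariant′ = record { optimal = optimal′ ; centres-were = centres-were′
                        ; centres-covered = centres-covered′ ; spokes = spokes′ }

  invariant : ∀ {K} → Reach K → Invariant K
  invariant origin = record
    { optimal = optimalH ; centres-were = λ _ centre → centre ; centres-covered = λ _ centre → proj₁ centre
    ; spokes = λ _ _ e _ coloured e-c e-ℓ _ → inj₁ (e , coloured , e-c , e-ℓ) }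
  invariant (step reachK s centre-z) = StepPreserves.invariant′ reachK (invariant reachK) s centre-z

  neighbour-centre : ∀ {x z f} → Uncoverable x → Inc f x → Inc f z → z ≢ x → Centre H z
  neighbour-centre (K , reachK , ¬cov) f-x f-z z≢x =
    centres-were _ (centre-lemma optimal ¬cov f-x f-z z≢x)
    where open Invariant (invariant reachK)

  not-centre : ∀ {x} → Uncoverable x → ¬ Centre H x
  not-centre (K , reachK , ¬cov) centre = ¬cov (red , centres-covered _ centre red)
    where open Invariant (invariant reachK)

  spoke-uncoverable : ∀ {x z ℓ f e} → Uncoverable x → Inc f x → Inc f z → Centre H z →
                      Coloured (H e) → Inc e z → Inc e ℓ → ℓ ≢ z → Uncoverable ℓ
  spoke-uncoverable {x} {z} {ℓ} {f} {e} uncoverable@(K , reachK , ¬cov) f-x f-z centreH coloured e-z e-ℓ ℓ≢z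
    with Invariant.spokes (invariant reachK) z ℓ e centreH coloured e-z e-ℓ ℓ≢z
  ... | inj₂ ℓ-uncoverable = ℓ-uncoverable
  ... | inj₁ (a , (d , Ka) , a-z , a-ℓ) =
    swap site , step reachK site centre-z , SwapFacts.p-uncovered (proj₁ optimal) site ℓ-misses
    where
    open Invariant (invariant reachK)
    z≢x : z ≢ x
    z≢x refl = not-centre uncoverable centreH
    centre-z : Centre K z
    centre-z = centre-lemma optimal ¬cov f-x f-z z≢x
    ℓ-misses : ¬ CoveredBy K (opposite d) ℓ
    ℓ-misses = proj₂ centre-z d a ℓ Ka a-z a-ℓ ℓ≢z
    site : Site K
    site = record { x = x ; z = z ; p = ℓ ; f = f ; a = a ; d = d ; x-uncovered = ¬cov
                  ; f-x = f-x ; f-z = f-z ; z≢x = z≢x ; a-colour = Ka ; a-z = a-z ; a-p = a-ℓ ; p≢z = ℓ≢z }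

-- The shape of the per-edge inequality in the counting argument.
one-sided : ∀ {a b c d} → a ≤ 1 → b ≡ 0 → d ≡ 1 → a + b ≤ c + d
one-sided {a} {c = c} a≤1 refl refl = ≤-trans (≤-reflexive (+-identityʳ a)) (≤-trans a≤1 (m≤n+m 1 c))

-- Suppose an optimal colouring H of an r-regular
-- graph (r ≥ 1) leaves v₀ uncovered, and (classically) decide which vertices
-- are uncoverable and which are centres of H.  Call a centre of H adjacent to
-- an uncoverable vertex a hub, and a coloured edge of H at a hub a hub edge.
--   * Uncoverable vertices are pairwise non-adjacent and all their neighbours
--     are hubs, so by regularity #uncoverable ≤ #hubs.
--   * Each hub edge joins a hub to an uncoverable vertex; a hub meets at least
--     two hub edges, an uncoverable vertex at most one, and v₀ none.
--     Double counting hub edges gives 2 · #hubs < #uncoverable.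
-- Together these are contradictory.
module Counting (G : Graph) {r : ℕ} (r≥1 : r ≥ 1) (regular : Regular r G)
                (H : Colourings.Colouring G) (optimalH : Colourings.Optimal G H)
                (v₀ : Fin (n G)) (v₀-uncovered : ¬ Colourings.Covered G H v₀) where

  open GraphFacts G
  open Colourings G
  open Centres G
  open Reachability G H optimalH

  Adjacent : Vertex → Vertex → Set
  Adjacent x z = ∃[ f ] (Inc f x × Inc f z)

  Hub : Vertex → Set
  Hub z = Centre H z × ∃[ x ] (Uncoverable x × Adjacent x z)

  HubEdge : Edge → Set
  HubEdge e = Coloured (H e) × (Hub (endA e) ⊎ Hub (endB e))

  make-hub : ∀ {x z f} → Uncoverable x → Inc f x → Inc f z → z ≢ x → Hub z
  make-hub {x} {z} {f} uncoverable f-x f-z z≢x =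
    neighbour-centre uncoverable f-x f-z z≢x , x , uncoverable , f , f-x , f-z

  hub-edge-far-end : ∀ {e z ℓ} → Coloured (H e) → Hub z → Inc e z → Inc e ℓ → ℓ ≢ z → Uncoverable ℓ
  hub-edge-far-end coloured (centreH , x , uncoverable , f , f-x , f-z) =
    spoke-uncoverable uncoverable f-x f-z centreH coloured

  -- An uncoverable vertex meets at most one hub edge: two hub edges of the same
  -- colour would violate properness, and of different colours leafiness of the
  -- hub at the other end.
  unique-hub-edge : ∀ {x} → Uncoverable x → ∀ e e' → HubEdge e × Inc e x → HubEdge e' × Inc e' x → e ≡ e'
  unique-hub-edge {x} uncoverable e e' (((d , He) , hub-end) , e-x) (((d' , He') , _) , e'-x) with e ≟ e'
  ... | yes e≡e' = e≡e'
  ... | no e≢e' with d' ≟ᶜ d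
  ...   | yes refl = ⊥-elim (proj₁ optimalH d e e' He He' e≢e' x e-x e'-x)
  ...   | no d'≢d  = ⊥-elim ([ violates (inj₁ refl) , violates (inj₂ refl) ]′ hub-end)
    where
    violates : ∀ {c} → Inc e c → Hub c → ⊥
    violates {c} e-c (centre@(_ , leafy) , _) =
      leafy d e x He e-c e-x x≢c (e' , trans He' (cong just (other-colour d'≢d)) , e'-x)
      where
      x≢c : x ≢ c
      x≢c refl = not-centre uncoverable centre

  module Decided (uncoverable? : ∀ x → Dec (Uncoverable x)) (centre? : ∀ x → Dec (Centre H x)) where

    hub? : ∀ z → Dec (Hub z)
    hub? z = centre? z ×-dec any? λ x → uncoverable? x ×-dec any? λ f → inc? f x ×-dec inc? f z

    hubEdge? : ∀ e → Dec (HubEdge e)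
    hubEdge? e = coloured? (H e) ×-dec (hub? (endA e) ⊎-dec hub? (endB e))

    u h : Vertex → ℕ
    u x = 𝟙 (uncoverable? x)
    h x = 𝟙 (hub? x)

    hubDegree : Vertex → ℕ
    hubDegree x = count (λ e → hubEdge? e ×-dec inc? e x)

    uncoverable-ends≤hub-ends : ∀ e → u (endA e) + u (endB e) ≤ h (endA e) + h (endB e)
    uncoverable-ends≤hub-ends e with uncoverable? (endA e) | uncoverable? (endB e)
    ... | yes uA | yes uB = ⊥-elim (not-centre uB (neighbour-centre uA (inj₁ refl) (inj₂ refl) (endB≢endA e)))
    ... | yes uA | no _   = ≤-trans (≤-reflexive (sym (𝟙-yes (hub? (endB e)) hubB))) (m≤n+m _ (h (endA e)))
      where
      hubB : Hub (endB e)
      hubB = make-hub uA (inj₁ refl) (inj₂ refl) (endB≢endA e)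
    ... | no _   | yes uB = ≤-trans (≤-reflexive (sym (𝟙-yes (hub? (endA e)) hubA))) (m≤m+n _ (h (endB e)))
      where
      hubA : Hub (endA e)
      hubA = make-hub uB (inj₂ refl) (inj₁ refl) (loopless G e)
    ... | no _   | no _   = z≤n

    -- A hub edge has exactly one hub end; its other end is uncoverable.
    hub-edge-ends : ∀ e → HubEdge e → h (endA e) + h (endB e) ≤ u (endA e) + u (endB e)
    hub-edge-ends e (coloured , inj₁ hubA) =
      one-sided (𝟙≤1 (hub? (endA e))) (𝟙-no (hub? (endB e)) (not-centre uB ∘ proj₁))
                (𝟙-yes (uncoverable? (endB e)) uB)
      where
      uB : Uncoverable (endB e)
      uB = hub-edge-far-end coloured hubA (inj₁ refl) (inj₂ refl) (endB≢endA e)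
    hub-edge-ends e (coloured , inj₂ hubB) = begin
      h (endA e) + h (endB e)   ≡⟨ +-comm (h (endA e)) _ ⟩
      h (endB e) + h (endA e)   ≤⟨ one-sided (𝟙≤1 (hub? (endB e))) (𝟙-no (hub? (endA e)) (not-centre uA ∘ proj₁))
                                             (𝟙-yes (uncoverable? (endA e)) uA) ⟩
      u (endB e) + u (endA e)   ≡⟨ +-comm (u (endB e)) _ ⟩
      u (endA e) + u (endB e)   ∎
      where
      open ≤-Reasoning
      uA : Uncoverable (endA e)
      uA = hub-edge-far-end coloured hubB (inj₂ refl) (inj₁ refl) (loopless G e)

    #uncoverable≤#hubs : sum u ≤ sum h
    #uncoverable≤#hubs = *-cancelʳ-≤ (sum u) (sum h) r {{>-nonZero r≥1}} (begin
      sum u * r                                  ≡⟨ regular-handshake regular u ⟩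
      sum (λ e → u (endA e) + u (endB e))        ≤⟨ sum-mono uncoverable-ends≤hub-ends ⟩
      sum (λ e → h (endA e) + h (endB e))        ≡⟨ regular-handshake regular h ⟨
      sum h * r                                  ∎)
      where open ≤-Reasoning

    hub-edges-from-hubs≤from-uncoverables : sum (λ x → h x * hubDegree x) ≤ sum (λ x → u x * hubDegree x)
    hub-edges-from-hubs≤from-uncoverables = begin
      sum (λ x → h x * hubDegree x)              ≡⟨ sum-cong-≗ (λ x → cong (h x *_) (weighted x)) ⟩
      sum (λ x → h x * weightedDegree W x)       ≡⟨ handshake h W ⟩
      sum (λ e → W e * (h (endA e) + h (endB e))) ≤⟨ sum-mono per-edge ⟩
      sum (λ e → W e * (u (endA e) + u (endB e))) ≡⟨ handshake u W ⟨
      sum (λ x → u x * weightedDegree W x)       ≡⟨ sum-cong-≗ (λ x → cong (u x *_) (weighted x)) ⟨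
      sum (λ x → u x * hubDegree x)              ∎
      where
      open ≤-Reasoning
      W : Edge → ℕ
      W e = 𝟙 (hubEdge? e)
      weighted : ∀ x → hubDegree x ≡ weightedDegree W x
      weighted x = sum-cong-≗ (λ e → 𝟙-× (hubEdge? e) (inc? e x))
      per-edge : ∀ e → W e * (h (endA e) + h (endB e)) ≤ W e * (u (endA e) + u (endB e))
      per-edge e with hubEdge? e
      ... | yes hubEdge = *-monoʳ-≤ 1 (hub-edge-ends e hubEdge)
      ... | no _        = z≤n

    -- A hub meets hub edges of both colours.
    hub-degree≥2 : ∀ x → Hub x → 2 ≤ hubDegree x
    hub-degree≥2 x hub@((both , _) , _) with both red | both blue
    ... | e₁ , He₁ , e₁-x | e₂ , He₂ , e₂-x =
      count-≥2 (λ e → hubEdge? e ×-dec inc? e x) e₁≢e₂ (hub-edge He₁ e₁-x , e₁-x) (hub-edge He₂ e₂-x , e₂-x)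
      where
      e₁≢e₂ : e₁ ≢ e₂
      e₁≢e₂ refl = case trans (sym He₁) He₂ of λ ()
      hub-edge : ∀ {e d} → H e ≡ just d → Inc e x → HubEdge e
      hub-edge He (inj₁ A≡x) = (_ , He) , inj₁ (subst Hub (sym A≡x) hub)
      hub-edge He (inj₂ B≡x) = (_ , He) , inj₂ (subst Hub (sym B≡x) hub)

    uncoverable-degree≤1 : ∀ x → Uncoverable x → hubDegree x ≤ 1
    uncoverable-degree≤1 x uncoverable = count-≤1 (λ e → hubEdge? e ×-dec inc? e x) (unique-hub-edge uncoverable)

    v₀-degree : hubDegree v₀ ≡ 0
    v₀-degree = count-0 (λ e → hubEdge? e ×-dec inc? e v₀)
      (λ e (((d , He) , _) , e-v₀) → v₀-uncovered (d , e , He , e-v₀))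

    contradiction : ⊥
    contradiction = <-irrefl refl (begin-strict
      sum h + sum h                     ≡⟨ ∑-distrib-+ h h ⟨
      sum (λ x → h x + h x)             ≤⟨ sum-mono hub-bound ⟩
      sum (λ x → h x * hubDegree x)     ≤⟨ hub-edges-from-hubs≤from-uncoverables ⟩
      sum (λ x → u x * hubDegree x)     <⟨ sum-mono-< uncoverable-bound v₀ v₀-strict ⟩
      sum u                             ≤⟨ #uncoverable≤#hubs ⟩
      sum h                             ≤⟨ m≤m+n (sum h) (sum h) ⟩
      sum h + sum h                     ∎)
      where
      open ≤-Reasoning
      hub-bound : ∀ x → h x + h x ≤ h x * hubDegree x
      hub-bound x with hub? x
      ... | yes hub = ≤-trans (hub-degree≥2 x hub) (≤-reflexive (sym (+-identityʳ _)))
      ... | no _    = z≤n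
      uncoverable-bound : ∀ x → u x * hubDegree x ≤ u x
      uncoverable-bound x with uncoverable? x
      ... | yes uncoverable = ≤-trans (≤-reflexive (+-identityʳ _)) (uncoverable-degree≤1 x uncoverable)
      ... | no _            = z≤n
      v₀-strict : u v₀ * hubDegree v₀ < u v₀
      v₀-strict rewrite 𝟙-yes (uncoverable? v₀) (H , origin , v₀-uncovered) | v₀-degree = ≤-refl

-- Classically every predicate on a finite set is decidable; constructively
-- this holds under double negation, which suffices for deriving ⊥.
¬¬-decidable : ∀ {k p} (P : Fin k → Set p) → ¬ ¬ (∀ i → Dec (P i))
¬¬-decidable {zero}  P undecided = undecided λ ()
¬¬-decidable {suc k} P undecided = ¬¬-excluded-middle λ dec₀ →
  ¬¬-decidable (P ∘ suc) λ decₛ → undecided (∀-cons dec₀ decₛ)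

optimal-covers : (G : Graph) {r : ℕ} → r ≥ 1 → Regular r G → ∀ {H} → Colourings.Optimal G H →
                 ∀ v → Colourings.Covered G H v
optimal-covers G r≥1 regular {H} optimalH v with Colourings.covered? G H v
... | yes covered = covered
... | no uncovered = ⊥-elim
  (¬¬-decidable Uncoverable λ uncoverable? → ¬¬-decidable (Centre H) λ centre? →
    Counting.Decided.contradiction G r≥1 regular H optimalH v uncovered uncoverable? centre?)
  where
  open Centres G
  open Reachability G H optimalH

-- Every ℕ-valued function on vectors over a finitely enumerable type attains
-- a maximum: choose the best vector coordinate by coordinate.
module Maximisation {A : Set} (a₀ : A) (elements : List A) (complete : ∀ a → a ∈ˡ elements) where

  best : ∀ k → (Vec A k → ℕ) → Vec A k
  best zero    g = []
  best (suc k) g = argmax g (extend a₀) (List.map extend elements)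
    where
    extend : A → Vec A (suc k)
    extend a = a ∷ best k (g ∘ (a ∷_))

  best-maximal : ∀ k (g : Vec A k → ℕ) w → g w ≤ g (best k g)
  best-maximal zero    g []      = ≤-refl
  best-maximal (suc k) g (a ∷ w) = ≤-trans (best-maximal k (g ∘ (a ∷_)) w)
    (v≤f[argmax]⁺ {f = g} _ _ (inj₂ (map⁺ (Any.map (λ { refl → ≤-refl }) (complete a)))))

-- Optimal colourings exist: maximise over all vectors of colours, ranking
-- proper colourings by one plus their score and improper ones by zero.
module Existence (G : Graph) where

  open Colourings G

  colour-values : List (Maybe Colour)
  colour-values = nothing ∷ just red ∷ just blue ∷ []

  all-colour-values : ∀ c → c ∈ˡ colour-values
  all-colour-values nothing     = here refl
  all-colour-values (just red)  = there (here refl)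
  all-colour-values (just blue) = there (there (here refl))

  open Maximisation nothing colour-values all-colour-values

  proper-cong : ∀ {K K'} → K ≗ K' → Proper K → Proper K'
  proper-cong K≗K' properK d e f K'e K'f = properK d e f (trans (K≗K' e) K'e) (trans (K≗K' f) K'f)

  score-cong : ∀ {K K'} → K ≗ K' → score K ≡ score K'
  score-cong {K} {K'} K≗K' = cong₂ (λ s c → s * suc (n G) + c)
    (sum-cong-≗ λ e → cong (𝟙 ∘ coloured?) (K≗K' e))
    (sum-cong-≗ λ x → ≤-antisym (𝟙-mono (covered? K x) (covered? K' x) (transport K≗K'))
                                (𝟙-mono (covered? K' x) (covered? K x) (transport (sym ∘ K≗K'))))
    where
    transport : ∀ {K K' x} → K ≗ K' → Covered K x → Covered K' x
    transport K≗K' (d , e , Ke , e-x) = d , e , trans (sym (K≗K' e)) Ke , e-x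

  rank : Vec (Maybe Colour) (m G) → ℕ
  rank w with proper? (lookup w)
  ... | yes _ = suc (score (lookup w))
  ... | no  _ = 0

  rank-proper : ∀ w → Proper (lookup w) → rank w ≡ suc (score (lookup w))
  rank-proper w proper with proper? (lookup w)
  ... | yes _    = refl
  ... | no  ¬pr  = ⊥-elim (¬pr proper)

  proper-ranked : ∀ w → 1 ≤ rank w → Proper (lookup w)
  proper-ranked w 1≤rank with proper? (lookup w)
  ... | yes proper = proper

  optimal-exists : ∃[ K ] Optimal K
  optimal-exists = lookup top , properTop , beats
    where
    top empty : Vec (Maybe Colour) (m G)
    top   = best (m G) rank
    empty = replicate (m G) nothing
    properEmpty : Proper (lookup empty)
    properEmpty d e _ Ke = case trans (sym (lookup-replicate e nothing)) Ke of λ ()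
    properTop : Proper (lookup top)
    properTop = proper-ranked top (begin
      1                               ≤⟨ s≤s z≤n ⟩
      suc (score (lookup empty))      ≡⟨ rank-proper empty properEmpty ⟨
      rank empty                      ≤⟨ best-maximal (m G) rank empty ⟩
      rank top                        ∎)
      where open ≤-Reasoning
    beats : ∀ K → Proper K → score K ≤ score (lookup top)
    beats K properK = ≤-pred (begin
      suc (score K)                   ≡⟨ cong suc (score-cong (sym ∘ lookup∘tabulate K)) ⟩
      suc (score (lookup (tabulate K))) ≡⟨ rank-proper (tabulate K) (proper-cong (sym ∘ lookup∘tabulate K) properK) ⟨
      rank (tabulate K)               ≤⟨ best-maximal (m G) rank (tabulate K) ⟩
      rank top                        ≡⟨ rank-proper top properTop ⟩
      suc (score (lookup top))        ∎)
      where open ≤-Reasoning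

module EdgeSets (G : Graph) where

  open GraphFacts G
  open Colourings G

  isColour : Maybe Colour → Colour → Bool
  isColour c d = does (≡-dec _≟ᶜ_ c (just d))

  isColoured : Maybe Colour → Bool
  isColoured c = isColour c red ∨ isColour c blue

  isColoured-inside : ∀ c → Coloured c → isColoured c ≡ inside
  isColoured-inside (just red)  _ = refl
  isColoured-inside (just blue) _ = refl

  𝟙-isColoured : ∀ c → 𝟙 (isColoured c ≟ᵇ inside) ≡ 𝟙 (coloured? c)
  𝟙-isColoured nothing     = refl
  𝟙-isColoured (just red)  = refl
  𝟙-isColoured (just blue) = refl

  colourClass : Colouring → Colour → EdgeSet G
  colourClass K d = tabulate λ e → isColour (K e) d

  ∈-colourClass : ∀ {K d e} → e ∈ colourClass K d → K e ≡ just d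
  ∈-colourClass {K} {d} {e} e∈ = does-witness (≡-dec _≟ᶜ_ (K e) (just d))
    (trans (sym (lookup∘tabulate _ e)) ([]=⇒lookup e∈))

  edgeSet : Colouring → EdgeSet G
  edgeSet K = colourClass K red ∪ colourClass K blue

  lookup-edgeSet : ∀ K e → lookup (edgeSet K) e ≡ isColoured (K e)
  lookup-edgeSet K e = trans (lookup-zipWith _∨_ e (colourClass K red) (colourClass K blue))
                             (cong₂ _∨_ (lookup∘tabulate _ e) (lookup∘tabulate _ e))

  two-colourable : ∀ {K} → Proper K → TwoEdgeColorable G (edgeSet K)
  two-colourable {K} properK = colourClass K red , colourClass K blue , matching red , matching blue , refl
    where
    matching : ∀ d → IsMatching G (colourClass K d)
    matching d e f e∈ f∈ = properK d e f (∈-colourClass {K} e∈) (∈-colourClass {K} f∈)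

  ∣edgeSet∣ : ∀ K → ∣ edgeSet K ∣ ≡ size K
  ∣edgeSet∣ K = trans ∣ edgeSet K ∣≡sum
    (sum-cong-≗ λ e → trans (cong (λ b → 𝟙 (b ≟ᵇ inside)) (lookup-edgeSet K e)) (𝟙-isColoured (K e)))

  spanning : ∀ {K} → (∀ v → Covered K v) → Spanning G (edgeSet K)
  spanning {K} covers v with covers v
  ... | d , e , Ke , e-v = begin
    1                        ≤⟨ count-≥1 inSubgraph? (e-v , e∈) ⟩
    count inSubgraph?        ≡⟨ length-filter inSubgraph? (λ e → e) ⟨
    degreeIn G (edgeSet K) v ∎
    where
    open ≤-Reasoning
    inSubgraph? : ∀ e → Dec (Incident G e v × e ∈ edgeSet K)
    inSubgraph? e = incident? G v e ×-dec e ∈? edgeSet K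
    e∈ : e ∈ edgeSet K
    e∈ = lookup⇒[]= e (edgeSet K) (trans (lookup-edgeSet K e) (isColoured-inside (K e) (d , Ke)))

  colourOf : Bool → Bool → Maybe Colour
  colourOf true  _     = just red
  colourOf false true  = just blue
  colourOf false false = nothing

  fromMatchings : EdgeSet G → EdgeSet G → Colouring
  fromMatchings M₁ M₂ e = colourOf (lookup M₁ e) (lookup M₂ e)

  fromMatchings-proper : ∀ {M₁ M₂} → IsMatching G M₁ → IsMatching G M₂ → Proper (fromMatchings M₁ M₂)
  fromMatchings-proper {M₁} {M₂} matching₁ matching₂ red e f Ke Kf =
    matching₁ e f (lookup⇒[]= e M₁ (red-in Ke)) (lookup⇒[]= f M₁ (red-in Kf))
    where
    red-in : ∀ {b₁ b₂} → colourOf b₁ b₂ ≡ just red → b₁ ≡ true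
    red-in {true} _ = refl
    red-in {false} {true} ()
    red-in {false} {false} ()
  fromMatchings-proper {M₁} {M₂} matching₁ matching₂ blue e f Ke Kf =
    matching₂ e f (lookup⇒[]= e M₂ (blue-in Ke)) (lookup⇒[]= f M₂ (blue-in Kf))
    where
    blue-in : ∀ {b₁ b₂} → colourOf b₁ b₂ ≡ just blue → b₂ ≡ true
    blue-in {true} ()
    blue-in {false} {true} _ = refl
    blue-in {false} {false} ()

  size-fromMatchings : ∀ M₁ M₂ → ∣ M₁ ∪ M₂ ∣ ≡ size (fromMatchings M₁ M₂)
  size-fromMatchings M₁ M₂ = trans ∣ M₁ ∪ M₂ ∣≡sum
    (sum-cong-≗ λ e → trans (cong (λ b → 𝟙 (b ≟ᵇ inside)) (lookup-zipWith _∨_ e M₁ M₂))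
                            (in-union (lookup M₁ e) (lookup M₂ e)))
    where
    in-union : ∀ b₁ b₂ → 𝟙 ((b₁ ∨ b₂) ≟ᵇ inside) ≡ 𝟙 (coloured? (colourOf b₁ b₂))
    in-union true  _     = refl
    in-union false true  = refl
    in-union false false = refl

  optimal-maximum : ∀ {K} → Optimal K → IsMax2EdgeColorable G (edgeSet K)
  optimal-maximum {K} optimalK = two-colourable (proj₁ optimalK) , maximum
    where
    maximum : ∀ H' → TwoEdgeColorable G H' → ∣ H' ∣ ≤ ∣ edgeSet K ∣
    maximum H' (M₁ , M₂ , matching₁ , matching₂ , refl) = begin
      ∣ M₁ ∪ M₂ ∣                  ≡⟨ size-fromMatchings M₁ M₂ ⟩
      size (fromMatchings M₁ M₂)   ≤⟨ optimal-size optimalK (fromMatchings-proper matching₁ matching₂) ⟩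
      size K                       ≡⟨ ∣edgeSet∣ K ⟨
      ∣ edgeSet K ∣                ∎
      where open ≤-Reasoning

mainTheorem12 : (r : ℕ) → r ≥ 1 → (G : Graph) → Regular r G →
    ∃[ H ] (IsMax2EdgeColorable G H × Spanning G H)
mainTheorem12 r r≥1 G regular =
  edgeSet K , optimal-maximum optimalK , spanning (optimal-covers G r≥1 regular optimalK)
  where
  open Colourings G using (Colouring; Optimal)
  open EdgeSets G
  open Existence G using (optimal-exists)
  K : Colouring
  K = proj₁ optimal-exists
  optimalK : Optimal K
  optimalK = proj₂ optimal-exists
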